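{- Fix $L>0$, $0<\alpha<L/2$, $0<\beta<L/2$, and consider the instance consisting of $N$ identical copies of $I_1=[0,L)$ together with one copy of $I_2=[\alpha-L,\alpha)$ and one copy of $I_3=[L-\beta,2L-\beta)$, arriving in a uniformly random order. The always-replace algorithm (which, whenever the new interval conflicts with its current solution, takes the new interval and discards the conflicting ones) has competitive ratio $2$ on this instance: with probability tending to $1$ as $N\to\infty$, its final solution contains one interval while $\mathrm{OPT}=2$.
   Context: Unweighted online interval selection with revocable decisions: intervals $[s,f)$ arrive one at a time, and the algorithm maintains a set of pairwise non-conflicting (disjoint) intervals, being allowed on each arrival to take the new interval while discarding currently held intervals that conflict with it; discarded or rejected intervals cannot be taken again. $\mathrm{OPT}$ is the maximum number of pairwise disjoint intervals of the instance, and the competitive ratio is $\mathrm{OPT}/\mathrm{ALG}$, which under random arrival order is required to hold with high probability.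
   Formalization: The parameters $L$, $\alpha$ and $\beta$ are rational, so all interval endpoints of the instance are rational as well. -}

module Defs where

open import Data.Nat using (ℕ)
open import Data.Rational using (ℚ; _<_; _+_; _-_; 0ℚ)
open import Data.Rational.Properties using (_<?_)
open import Data.Product using (_×_; _,_; proj₁; proj₂)
open import Data.List using (List; []; _∷_; concatMap; map; replicate; filter; foldl; length)
open import Relation.Nullary using (¬_; Dec; ¬?)
open import Relation.Nullary.Decidable using (_×-dec_)

-- A half-open interval [s , f) represented by its endpoints (s , f).
Interval : Set
Interval = ℚ × ℚ

start finish : Interval → ℚ
start = proj₁
finish = proj₂

Conflict : Interval → Interval → Set
Conflict i j = (start i < finish j) × (start j < finish i)

conflict? : (i j : Interval) → Dec (Conflict i j)
conflict? i j = (start i <? finish j) ×-dec (start j <? finish i)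

Disjoint : Interval → Interval → Set
Disjoint i j = ¬ Conflict i j

arStep : List Interval → Interval → List Interval
arStep S x = x ∷ filter (λ y → ¬? (conflict? x y)) S

alwaysReplace : List Interval → List Interval
alwaysReplace = foldl arStep []

insertions : {A : Set} → A → List A → List (List A)
insertions x [] = (x ∷ []) ∷ []
insertions x (y ∷ ys) = (x ∷ y ∷ ys) ∷ map (y ∷_) (insertions x ys)

-- All n! arrival orders of the (labelled) items of a list, each listed once
-- per labelled permutation; the uniformly random order is the uniform
-- distribution on this list (with multiplicity).
permutations : {A : Set} → List A → List (List A)
permutations [] = [] ∷ []
permutations (x ∷ xs) = concatMap (insertions x) (permutations xs)

instanceI : ℚ → ℚ → ℚ → ℕ → List Interval
instanceI L α β N = (α - L , α) ∷ (L - β , (L + L) - β) ∷ replicate N (0ℚ , L)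

-- Every copy of I₁ meets every interval of the instance. So if one of the last two
-- arrivals is a copy of I₁, always-replace ends with a single interval: a late I₁
-- discards everything, and the arrival right after it discards that I₁. The final
-- solution can thus have two intervals only if I₂ and I₃ arrive last. Orders arise by
-- inserting I₂ into an order of the other N + 1 intervals, in which I₂ and I₃ are never
-- last; only the last two insertion points can change the final pair, so at most
-- 2 · (N+1)! of the (N+2)! orders are bad. OPT = 2 because I₂ and I₃ are disjoint, while
-- a disjoint family containing a copy of I₁ contains nothing else.
module Submission where

open import Defs
open import Data.Nat using (ℕ; suc; _≤_; _≟_; z≤n; s≤s; _!) renaming (_<_ to _<ℕ_; _*_ to _*ℕ_; _+_ to _+ℕ_)
open import Data.Nat.Properties as ℕ using (_!≢0)
open import Data.Nat.Solver using (module +-*-Solver)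
open import Data.Rational using (ℚ; _<_; _*_; _+_; _-_; -_; 0ℚ; ½)
open import Data.Rational.Properties using (<-trans; <-asym; +-monoˡ-<; +-monoʳ-<; +-mono-<; +-identityʳ; +-identityˡ; +-inverseʳ)
open import Data.Rational.Solver renaming (module +-*-Solver to ℚ-Solver)
open import Data.Product using (_×_; _,_; ∃; ∃-syntax; swap)
open import Data.Sum using (_⊎_; inj₁; inj₂)
open import Data.Empty using (⊥-elim)
open import Data.List using (List; []; _∷_; _++_; length; filter; map; replicate; foldl; concatMap)
open import Data.List.Properties using (length-filter; filter-reject; filter-none; filter-++; length-++; length-map; length-replicate; map-++; map-∘; map-replicate; foldl-++)
open import Data.List.Relation.Unary.All as All using (All; []; _∷_)
open import Data.List.Relation.Unary.All.Properties using (concat⁺; map⁺; replicate⁺; filter⁺)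
open import Data.List.Relation.Unary.AllPairs using (AllPairs; []; _∷_)
open import Data.List.Relation.Binary.Sublist.Propositional using (_⊆_; []; _∷_; _∷ʳ_; minimum)
open import Data.List.Relation.Binary.Sublist.Propositional.Properties using (All-resp-⊆)
open import Function using (_∘_)
open import Relation.Binary.PropositionalEquality using (_≡_; refl; sym; trans; cong; cong₂; subst; subst₂; module ≡-Reasoning)
open import Relation.Nullary using (¬_; ¬?; yes; no)
open import Relation.Nullary.Decidable using (map′; decidable-stable)
open import Relation.Unary using (Decidable)

private
  variable
    A B : Set

length-concatMap : (g : A → List B) (m : ℕ) {xs : List A} →
  All (λ x → length (g x) ≡ m) xs → length (concatMap g xs) ≡ length xs *ℕ m
length-concatMap g m []       = refl
length-concatMap g m {x ∷ xs} (e ∷ es) =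
  trans (length-++ (g x)) (cong₂ _+ℕ_ e (length-concatMap g m es))

length-filter-concatMap-≤ : {P : B → Set} (P? : Decidable P) (g : A → List B) (m : ℕ) {xs : List A} →
  All (λ x → length (filter P? (g x)) ≤ m) xs → length (filter P? (concatMap g xs)) ≤ length xs *ℕ m
length-filter-concatMap-≤ P? g m []       = z≤n
length-filter-concatMap-≤ P? g m {x ∷ xs} (b ∷ bs) = begin
  length (filter P? (g x ++ concatMap g xs))                    ≡⟨ cong length (filter-++ P? (g x) _) ⟩
  length (filter P? (g x) ++ filter P? (concatMap g xs))        ≡⟨ length-++ (filter P? (g x)) ⟩
  length (filter P? (g x)) +ℕ length (filter P? (concatMap g xs)) ≤⟨ ℕ.+-mono-≤ b (length-filter-concatMap-≤ P? g m bs) ⟩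
  m +ℕ length xs *ℕ m                                            ∎
  where open ℕ.≤-Reasoning

length-filter-map-≤ : {P : B → Set} {Q : A → Set} (P? : Decidable P) (Q? : Decidable Q) (g : A → B) {xs : List A} →
  All (λ x → P (g x) → Q x) xs → length (filter P? (map g xs)) ≤ length (filter Q? xs)
length-filter-map-≤ P? Q? g [] = z≤n
length-filter-map-≤ P? Q? g {x ∷ xs} (imp ∷ imps) with P? (g x) | Q? x
... | yes p | no ¬q = ⊥-elim (¬q (imp p))
... | yes _ | yes _ = s≤s (length-filter-map-≤ P? Q? g imps)
... | no _  | yes _ = ℕ.m≤n⇒m≤1+n (length-filter-map-≤ P? Q? g imps)
... | no _  | no _  = length-filter-map-≤ P? Q? g imps

All-concatMap : {P : B → Set} (g : A → List B) {xs : List A} →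
  All (λ x → All P (g x)) xs → All P (concatMap g xs)
All-concatMap g = concat⁺ ∘ map⁺

length-insertions : (x : A) (ys : List A) → length (insertions x ys) ≡ suc (length ys)
length-insertions x []       = refl
length-insertions x (y ∷ ys) = cong suc (trans (length-map (y ∷_) (insertions x ys)) (length-insertions x ys))

insertions-length : (x : A) (ys : List A) → All (λ zs → length zs ≡ suc (length ys)) (insertions x ys)
insertions-length x []       = refl ∷ []
insertions-length x (y ∷ ys) = refl ∷ map⁺ (All.map (cong suc) (insertions-length x ys))

permutations-length : (xs : List A) → All (λ ys → length ys ≡ length xs) (permutations xs)
permutations-length []       = refl ∷ []
permutations-length (x ∷ xs) = All-concatMap (insertions x)
  (All.map (λ {ys} e → All.map (λ e′ → trans e′ (cong suc e)) (insertions-length x ys)) (permutations-length xs))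

length-permutations : (xs : List A) → length (permutations xs) ≡ length xs !
length-permutations []       = refl
length-permutations (x ∷ xs) = begin
  length (concatMap (insertions x) (permutations xs)) ≡⟨ length-concatMap (insertions x) (suc (length xs)) lengths ⟩
  length (permutations xs) *ℕ suc (length xs)          ≡⟨ cong (_*ℕ suc (length xs)) (length-permutations xs) ⟩
  length xs ! *ℕ suc (length xs)                       ≡⟨ ℕ.*-comm (length xs !) (suc (length xs)) ⟩
  suc (length xs) !                                    ∎
  where
  open ≡-Reasoning
  lengths : All (λ ys → length (insertions x ys) ≡ suc (length xs)) (permutations xs)
  lengths = All.map (λ {ys} e → trans (length-insertions x ys) (cong suc e)) (permutations-length xs)

insertions-map : (g : A → B) (x : A) (ys : List A) → insertions (g x) (map g ys) ≡ map (map g) (insertions x ys)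
insertions-map g x []       = refl
insertions-map g x (y ∷ ys) = cong ((g x ∷ g y ∷ map g ys) ∷_) (begin
  map (g y ∷_) (insertions (g x) (map g ys))   ≡⟨ cong (map (g y ∷_)) (insertions-map g x ys) ⟩
  map (g y ∷_) (map (map g) (insertions x ys)) ≡⟨ map-∘ (insertions x ys) ⟨
  map ((g y ∷_) ∘ map g) (insertions x ys)     ≡⟨ map-∘ (insertions x ys) ⟩
  map (map g) (map (y ∷_) (insertions x ys))   ∎)
  where open ≡-Reasoning

permutations-map : (g : A → B) (xs : List A) → permutations (map g xs) ≡ map (map g) (permutations xs)
permutations-map g []       = refl
permutations-map g (x ∷ xs) = trans (cong (concatMap (insertions (g x))) (permutations-map g xs)) (go (permutations xs))
  where
  go : (yss : List (List _)) →
    concatMap (insertions (g x)) (map (map g) yss) ≡ map (map g) (concatMap (insertions x) yss)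
  go []         = refl
  go (ys ∷ yss) = trans (cong₂ _++_ (insertions-map g x ys) (go yss)) (sym (map-++ (map g) (insertions x ys) _))

All-insertions : {P : A → Set} {x : A} {ys : List A} → P x → All P ys → All (All P) (insertions x ys)
All-insertions px []         = (px ∷ []) ∷ []
All-insertions px (py ∷ pys) = (px ∷ py ∷ pys) ∷ map⁺ (All.map (py ∷_) (All-insertions px pys))

All-permutations : {P : A → Set} {xs : List A} → All P xs → All (All P) (permutations xs)
All-permutations []         = [] ∷ []
All-permutations (px ∷ pxs) = All-concatMap (insertions _) (All.map (All-insertions px) (All-permutations pxs))

data EndsInTwo (P : A → Set) : List A → Set where
  here  : ∀ {x y} → P x → P y → EndsInTwo P (x ∷ y ∷ [])
  there : ∀ {x xs} → EndsInTwo P xs → EndsInTwo P (x ∷ xs)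

endsInTwo? : {P : A → Set} → Decidable P → Decidable (EndsInTwo P)
endsInTwo? P? []           = no λ ()
endsInTwo? P? (x ∷ [])     = no λ { (there ()) }
endsInTwo? P? (x ∷ y ∷ []) with P? x | P? y
... | yes px | yes py = yes (here px py)
... | no ¬px | _      = no λ { (here px _) → ¬px px ; (there (there ())) }
... | yes _  | no ¬py = no λ { (here _ py) → ¬py py ; (there (there ())) }
endsInTwo? P? (x ∷ y ∷ z ∷ zs) = map′ there (λ { (there e) → e }) (endsInTwo? P? (y ∷ z ∷ zs))

EndsInTwo-∷⁻ : {P : A → Set} {y : A} {zs : List A} → 2 ≤ length zs → EndsInTwo P (y ∷ zs) → EndsInTwo P zs
EndsInTwo-∷⁻ {zs = _ ∷ _ ∷ _} _         (there e) = e
EndsInTwo-∷⁻ {zs = _ ∷ []}    (s≤s ()) _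

All¬⇒¬EndsInTwo : {P : A → Set} {xs : List A} → All (¬_ ∘ P) xs → ¬ EndsInTwo P xs
All¬⇒¬EndsInTwo (¬px ∷ _) (here px _) = ¬px px
All¬⇒¬EndsInTwo (_ ∷ ¬ps) (there e)   = All¬⇒¬EndsInTwo ¬ps e

¬EndsInTwo⇒lastTwo : {P : A → Set} → Decidable P → ∀ x y zs → ¬ EndsInTwo P (x ∷ y ∷ zs) →
  ∃[ σ ] ∃[ a ] ∃[ b ] (x ∷ y ∷ zs ≡ σ ++ a ∷ b ∷ []) × (¬ P a ⊎ ¬ P b)
¬EndsInTwo⇒lastTwo P? x y [] ¬e with P? x | P? y
... | yes px | yes py = ⊥-elim (¬e (here px py))
... | no ¬px | _      = [] , x , y , refl , inj₁ ¬px
... | yes _  | no ¬py = [] , x , y , refl , inj₂ ¬py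
¬EndsInTwo⇒lastTwo P? x y (z ∷ zs) ¬e with ¬EndsInTwo⇒lastTwo P? y z zs (¬e ∘ there)
... | σ , a , b , eq , ¬ab = x ∷ σ , a , b , cong (x ∷_) eq , ¬ab

insertions-¬EndsInTwo : {P : A → Set} (x : A) {ys : List A} → All (¬_ ∘ P) ys →
  All (¬_ ∘ EndsInTwo P) (insertions x ys)
insertions-¬EndsInTwo x []          = (λ { (there ()) }) ∷ []
insertions-¬EndsInTwo x (¬py ∷ ¬ps) = head ∷ map⁺ (All.map tail (insertions-¬EndsInTwo x ¬ps))
  where
  head : ¬ EndsInTwo _ (x ∷ _ ∷ _)
  head (here _ py) = ¬py py
  head (there e)   = All¬⇒¬EndsInTwo (¬py ∷ ¬ps) e
  tail : ∀ {zs} → ¬ EndsInTwo _ zs → ¬ EndsInTwo _ (_ ∷ zs)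
  tail _  (here py _) = ¬py py
  tail ¬e (there e)   = ¬e e

-- All insertion points but the last two leave the final pair of ys in place.
filter-EndsInTwo-insertions-≤2 : {P : A → Set} (P? : Decidable P) (x : A) (ys : List A) →
  ¬ EndsInTwo P ys → length (filter (endsInTwo? P?) (insertions x ys)) ≤ 2
filter-EndsInTwo-insertions-≤2 P? x []       _ = ℕ.≤-trans (length-filter (endsInTwo? P?) (insertions x [])) (s≤s z≤n)
filter-EndsInTwo-insertions-≤2 P? x (y ∷ []) _ = length-filter (endsInTwo? P?) (insertions x (y ∷ []))
filter-EndsInTwo-insertions-≤2 P? x (y ∷ y′ ∷ ys) ¬e = begin
  length (filter E? ((x ∷ y ∷ y′ ∷ ys) ∷ map (y ∷_) (insertions x (y′ ∷ ys))))
    ≡⟨ cong length (filter-reject E? (¬e ∘ EndsInTwo-∷⁻ (s≤s (s≤s z≤n)))) ⟩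
  length (filter E? (map (y ∷_) (insertions x (y′ ∷ ys))))
    ≤⟨ length-filter-map-≤ E? E? (y ∷_) (All.map (λ e → EndsInTwo-∷⁻ (subst (2 ≤_) (sym e) (s≤s (s≤s z≤n))))
                                                    (insertions-length x (y′ ∷ ys))) ⟩
  length (filter E? (insertions x (y′ ∷ ys)))
    ≤⟨ filter-EndsInTwo-insertions-≤2 P? x (y′ ∷ ys) (¬e ∘ there) ⟩
  2 ∎
  where
  open ℕ.≤-Reasoning
  E? = endsInTwo? P?

arStep-conflictsAll : {x : Interval} {S : List Interval} → All (Conflict x) S → arStep S x ≡ x ∷ []
arStep-conflictsAll {x} c = cong (x ∷_) (filter-none (¬? ∘ conflict? x) (All.map (λ cxy ¬cxy → ¬cxy cxy) c))

All-arStep : {P : Interval → Set} {x : Interval} {S : List Interval} → P x → All P S → All P (arStep S x)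
All-arStep {x = x} px ps = px ∷ filter⁺ (¬? ∘ conflict? x) ps

All-foldl-arStep : {P : Interval → Set} {S τ : List Interval} → All P S → All P τ → All P (foldl arStep S τ)
All-foldl-arStep ps []         = ps
All-foldl-arStep ps (px ∷ pxs) = All-foldl-arStep (All-arStep px ps) pxs

alwaysReplace-All : {P : Interval → Set} {τ : List Interval} → All P τ → All P (alwaysReplace τ)
alwaysReplace-All = All-foldl-arStep []

alwaysReplace-hubLast : {c x : Interval} (σ : List Interval) → All (Conflict c) σ → Conflict c x →
  alwaysReplace (σ ++ x ∷ c ∷ []) ≡ c ∷ []
alwaysReplace-hubLast σ cσ cx = trans (foldl-++ arStep [] σ _)
  (arStep-conflictsAll (All-arStep cx (alwaysReplace-All cσ)))

alwaysReplace-hubSecondLast : {c x : Interval} (σ : List Interval) → All (Conflict c) σ → Conflict x c →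
  alwaysReplace (σ ++ c ∷ x ∷ []) ≡ x ∷ []
alwaysReplace-hubSecondLast {x = x} σ cσ xc = trans (foldl-++ arStep [] σ _)
  (trans (cong (λ S → arStep S x) (arStep-conflictsAll (alwaysReplace-All cσ))) (arStep-conflictsAll (xc ∷ [])))

disjoint-copies-empty : {x c : Interval} {T : List Interval} → Conflict x c → All (_≡ c) T → All (Disjoint x) T → T ≡ []
disjoint-copies-empty xc []         []      = refl
disjoint-copies-empty xc (refl ∷ _) (d ∷ _) = ⊥-elim (d xc)

⊆-replicate : {c : Interval} {T : List Interval} (N : ℕ) → T ⊆ replicate N c → All (_≡ c) T
⊆-replicate N p = All-resp-⊆ p (replicate⁺ N refl)

disjoint-⊆-length-≤2 : {a b c : Interval} {S : List Interval} (N : ℕ) → Conflict c c → Conflict a c → Conflict b c →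
  S ⊆ a ∷ b ∷ replicate N c → AllPairs Disjoint S → length S ≤ 2
disjoint-⊆-length-≤2 N cc ac bc (_ ∷ʳ _ ∷ʳ p) ds with ⊆-replicate N p | ds
... | []        | _      = z≤n
... | refl ∷ es | d ∷ _ with disjoint-copies-empty cc es d
...   | refl = s≤s z≤n
disjoint-⊆-length-≤2 N cc ac bc (_ ∷ʳ refl ∷ p) (d ∷ _) with disjoint-copies-empty bc (⊆-replicate N p) d
... | refl = s≤s z≤n
disjoint-⊆-length-≤2 N cc ac bc (refl ∷ _ ∷ʳ p) (d ∷ _) with disjoint-copies-empty ac (⊆-replicate N p) d
... | refl = s≤s z≤n
disjoint-⊆-length-≤2 N cc ac bc (refl ∷ refl ∷ p) ((_ ∷ d) ∷ _) with disjoint-copies-empty ac (⊆-replicate N p) d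
... | refl = s≤s (s≤s z≤n)

<-+⇒-< : ∀ {p q r} → p < q + r → p - q < r
<-+⇒-< {p} {q} {r} h = subst (p - q <_) (solve 2 (λ q r → (q :+ r) :- q := r) refl q r) (+-monoˡ-< (- q) h)
  where open ℚ-Solver

<⇒0<- : ∀ {p q} → q < p → 0ℚ < p - q
<⇒0<- {p} {q} h = subst (_< p - q) (+-inverseʳ q) (+-monoˡ-< (- q) h)

k*[[1+n]!*2]<[2+n]! : ∀ k n → 2 *ℕ k ≤ n → k *ℕ (suc n ! *ℕ 2) <ℕ suc (suc n) !
k*[[1+n]!*2]<[2+n]! k n 2k≤n = begin-strict
  k *ℕ (suc n ! *ℕ 2)  ≡⟨ solve 2 (λ k m → k :* (m :* con 2) := con 2 :* k :* m) refl k (suc n !) ⟩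
  2 *ℕ k *ℕ suc n !    ≤⟨ ℕ.*-monoˡ-≤ (suc n !) 2k≤n ⟩
  n *ℕ suc n !         <⟨ ℕ.*-monoˡ-< (suc n !) {{suc n !≢0}} (ℕ.m<n+m n {2} (s≤s z≤n)) ⟩
  suc (suc n) !        ∎
  where
  open ℕ.≤-Reasoning
  open +-*-Solver

data Label : Set where
  I₁ I₂ I₃ : Label

data Flank : Label → Set where
  flank₂ : Flank I₂
  flank₃ : Flank I₃

flank? : Decidable Flank
flank? I₁ = no λ ()
flank? I₂ = yes flank₂
flank? I₃ = yes flank₃

¬Flank⇒I₁ : ∀ {t} → ¬ Flank t → t ≡ I₁
¬Flank⇒I₁ {I₁} _  = refl
¬Flank⇒I₁ {I₂} ¬f = ⊥-elim (¬f flank₂)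
¬Flank⇒I₁ {I₃} ¬f = ⊥-elim (¬f flank₃)

labels : ℕ → List Label
labels N = I₂ ∷ I₃ ∷ replicate N I₁

filter-EndsInTwo-labels-≤ : ∀ N → length (filter (endsInTwo? flank?) (permutations (labels N))) ≤ suc N ! *ℕ 2
filter-EndsInTwo-labels-≤ N = subst (λ n → length (filter (endsInTwo? flank?) (permutations (labels N))) ≤ n *ℕ 2)
  (trans (length-permutations (I₃ ∷ replicate N I₁)) (cong (λ n → suc n !) (length-replicate N)))
  (length-filter-concatMap-≤ (endsInTwo? flank?) (insertions I₂) 2
    (All.map (λ {ys} ¬e → filter-EndsInTwo-insertions-≤2 flank? I₂ ys ¬e) oneFlank))
  where
  oneFlank : All (¬_ ∘ EndsInTwo Flank) (permutations (I₃ ∷ replicate N I₁))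
  oneFlank = All-concatMap (insertions I₃)
    (All.map (insertions-¬EndsInTwo I₃) (All-permutations (replicate⁺ N λ ())))

module Instance (L α β : ℚ) (0<L : 0ℚ < L) (0<α : 0ℚ < α) (α<L/2 : α < ½ * L) (0<β : 0ℚ < β) (β<L/2 : β < ½ * L) where

  interval : Label → Interval
  interval I₁ = (0ℚ , L)
  interval I₂ = (α - L , α)
  interval I₃ = (L - β , (L + L) - β)

  instanceI-labels : ∀ N → instanceI L α β N ≡ map interval (labels N)
  instanceI-labels N = cong (λ r → interval I₂ ∷ interval I₃ ∷ r) (sym (map-replicate interval N I₁))

  private
    ½L+½L≡L : ½ * L + ½ * L ≡ L
    ½L+½L≡L = solve 1 (λ L → con ½ :* L :+ con ½ :* L := L) refl L
      where open ℚ-Solver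

    L<L+L : L < L + L
    L<L+L = subst (_< L + L) (+-identityʳ L) (+-monoʳ-< L 0<L)

    ½L<L : ½ * L < L
    ½L<L = subst₂ _<_ (+-identityʳ (½ * L)) ½L+½L≡L (+-monoʳ-< (½ * L) (<-trans 0<α α<L/2))

    β<L : β < L
    β<L = <-trans β<L/2 ½L<L

  I₁-conflicts : ∀ t → Conflict (interval I₁) (interval t)
  I₁-conflicts I₁ = 0<L , 0<L
  I₁-conflicts I₂ = 0<α , <-+⇒-< (<-trans (<-trans α<L/2 ½L<L) L<L+L)
  I₁-conflicts I₃ = <⇒0<- (<-trans β<L L<L+L) , <-+⇒-< (subst (_< β + L) (+-identityˡ L) (+-monoˡ-< L 0<β))

  I₂-disjoint-I₃ : Disjoint (interval I₂) (interval I₃)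
  I₂-disjoint-I₃ (_ , L-β<α) = <-asym α+β<L (subst (_< α + β) L-β+β≡L (+-monoˡ-< β L-β<α))
    where
    α+β<L : α + β < L
    α+β<L = subst (α + β <_) ½L+½L≡L (+-mono-< α<L/2 β<L/2)
    L-β+β≡L : (L - β) + β ≡ L
    L-β+β≡L = solve 2 (λ L β → (L :- β) :+ β := L) refl L β
      where open ℚ-Solver

  alwaysReplace-lastTwo : ∀ σ a b → ¬ Flank a ⊎ ¬ Flank b →
    length (alwaysReplace (map interval σ ++ interval a ∷ interval b ∷ [])) ≡ 1
  alwaysReplace-lastTwo σ a b (inj₁ ¬fa) with refl ← ¬Flank⇒I₁ ¬fa =
    cong length (alwaysReplace-hubSecondLast (map interval σ) (map⁺ (All.universal I₁-conflicts σ)) (swap (I₁-conflicts b)))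
  alwaysReplace-lastTwo σ a b (inj₂ ¬fb) with refl ← ¬Flank⇒I₁ ¬fb =
    cong length (alwaysReplace-hubLast (map interval σ) (map⁺ (All.universal I₁-conflicts σ)) (I₁-conflicts a))

  alwaysReplace-single : ∀ τ → ¬ EndsInTwo Flank τ → 2 ≤ length τ → length (alwaysReplace (map interval τ)) ≡ 1
  alwaysReplace-single (_ ∷ [])     _  (s≤s ())
  alwaysReplace-single (x ∷ y ∷ zs) ¬e _ with ¬EndsInTwo⇒lastTwo flank? x y zs ¬e
  ... | σ , a , b , eq , ¬ab = subst (λ τ → length (alwaysReplace (map interval τ)) ≡ 1) (sym eq)
    (trans (cong (length ∘ alwaysReplace) (map-++ interval σ _)) (alwaysReplace-lastTwo σ a b ¬ab))

  ¬single⇒EndsInTwo : ∀ τ → 2 ≤ length τ → ¬ length (alwaysReplace (map interval τ)) ≡ 1 → EndsInTwo Flank τ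
  ¬single⇒EndsInTwo τ 2≤|τ| ¬single = decidable-stable (endsInTwo? flank? τ) (λ ¬e → ¬single (alwaysReplace-single τ ¬e 2≤|τ|))

  OPT≡2 : (N : ℕ) →
    (∃[ S ] (S ⊆ instanceI L α β N × AllPairs Disjoint S × length S ≡ 2))
    × (∀ S → S ⊆ instanceI L α β N → AllPairs Disjoint S → length S ≤ 2)
  OPT≡2 N = (_ , refl ∷ refl ∷ minimum _ , (I₂-disjoint-I₃ ∷ []) ∷ [] ∷ [] , refl)
          , λ S → disjoint-⊆-length-≤2 N (I₁-conflicts I₁) (swap (I₁-conflicts I₂)) (swap (I₁-conflicts I₃))

  length-filter-¬single-≤ : ∀ N →
    length (filter (λ σ → ¬? (length (alwaysReplace σ) ≟ 1)) (map (map interval) (permutations (labels N))))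
      ≤ length (filter (endsInTwo? flank?) (permutations (labels N)))
  length-filter-¬single-≤ N = length-filter-map-≤ (λ σ → ¬? (length (alwaysReplace σ) ≟ 1)) (endsInTwo? flank?) (map interval)
    (All.map (λ {τ} len → ¬single⇒EndsInTwo τ (subst (2 ≤_) (sym len) (s≤s (s≤s z≤n)))) (permutations-length (labels N)))

  ¬single-rare : ∀ k N → 2 *ℕ k ≤ N →
    k *ℕ length (filter (λ σ → ¬? (length (alwaysReplace σ) ≟ 1)) (permutations (instanceI L α β N)))
      <ℕ length (permutations (instanceI L α β N))
  ¬single-rare k N 2k≤N = subst (λ orders → k *ℕ length (filter (λ σ → ¬? (length (alwaysReplace σ) ≟ 1)) orders) <ℕ length orders)
    (sym (trans (cong permutations (instanceI-labels N)) (permutations-map interval (labels N))))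
    (begin-strict
      k *ℕ length (filter _ (map (map interval) (permutations (labels N))))
        ≤⟨ ℕ.*-monoʳ-≤ k (ℕ.≤-trans (length-filter-¬single-≤ N) (filter-EndsInTwo-labels-≤ N)) ⟩
      k *ℕ (suc N ! *ℕ 2)                                   <⟨ k*[[1+n]!*2]<[2+n]! k N 2k≤N ⟩
      suc (suc N) !                                         ≡⟨ cong (λ n → suc (suc n) !) (length-replicate N) ⟨
      length (labels N) !                                   ≡⟨ length-permutations (labels N) ⟨
      length (permutations (labels N))                      ≡⟨ length-map (map interval) (permutations (labels N)) ⟨
      length (map (map interval) (permutations (labels N))) ∎)
    where open ℕ.≤-Reasoning

lemma3 : (L α β : ℚ) → 0ℚ < L → 0ℚ < α → α < ½ * L → 0ℚ < β → β < ½ * L →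
    -- OPT = 2 (for every N)
    ((N : ℕ) →
      (∃[ S ] (S ⊆ instanceI L α β N × AllPairs Disjoint S × length S ≡ 2))
      × (∀ S → S ⊆ instanceI L α β N → AllPairs Disjoint S → length S ≤ 2))
    -- and Pr[ |ALG| ≠ 1 ] → 0 as N → ∞ under a uniformly random arrival order:
    -- for every k, eventually (#bad orders) * k < (#all orders).
    × (∀ (k : ℕ) → ∃[ N₀ ] ∀ (N : ℕ) → N₀ ≤ N →
        k *ℕ length (filter (λ σ → ¬? (length (alwaysReplace σ) ≟ 1))
                            (permutations (instanceI L α β N)))
          <ℕ length (permutations (instanceI L α β N)))
lemma3 L α β 0<L 0<α α<L/2 0<β β<L/2 = OPT≡2 , λ k → 2 *ℕ k , ¬single-rare k
  where open Instance L α β 0<L 0<α α<L/2 0<β β<L/2
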